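{- Let $S=\mathbb{F}[x_1,\dots,x_n]$, let $j>2$ be an integer and let $J\subseteq S$ be a lex ideal. Let $x_px_q$ be the lexicographically smallest monomial of degree $2$ that is contained in $J$. If $u\in G(J)_j$ is a minimal monomial generator of $J$ of degree $j$, then $u<_{\mathrm{lex}}x_px_qx_n^{j-2}$. In other words, $G(J)_j$ is contained in the set of degree-$j$ monomials of $S$ that are lexicographically smaller than $x_px_qx_n^{j-2}$.
   Context: $\mathbb{F}$ is a field. $>_{\mathrm{lex}}$ is the lexicographic order with $x_1>\dots>x_n$. A monomial ideal $L\subseteq S$ is a lex ideal if whenever $u\in L$ is a monomial and $v$ is a monomial of the same degree with $v>_{\mathrm{lex}}u$, then $v\in L$. For a monomial ideal $J$, $G(J)$ is its set of minimal monomial generators and $G(J)_j$ the elements of $G(J)$ of degree $j$. -}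

module Defs where

open import Data.Nat using (ℕ; zero; suc; _+_; _≤_; _<_; _>_)
open import Data.Fin using (Fin; fromℕ)
open import Data.Vec using (Vec; []; _∷_; zipWith; tabulate; sum)
open import Data.Vec.Relation.Binary.Pointwise.Inductive using (Pointwise)
open import Data.Product using (_×_)
open import Data.Sum using (_⊎_)
open import Relation.Binary.PropositionalEquality using (_≡_)
open import Relation.Nullary using (does)
open import Data.Fin using (_≟_)
open import Data.Bool using (if_then_else_)
open import Data.Empty using (⊥)

-- A monomial x_1^{a_1} ... x_n^{a_n} of S = F[x_1,...,x_n] is its exponent vector
-- (a_1, ..., a_n); the head of the vector is the exponent of x_1.
Mon : ℕ → Set
Mon n = Vec ℕ n

_·_ : ∀ {n} → Mon n → Mon n → Mon n
_·_ = zipWith _+_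

pow : ∀ {n} → Fin n → ℕ → Mon n
pow i k = tabulate (λ l → if does (l ≟ i) then k else 0)

var : ∀ {n} → Fin n → Mon n
var i = pow i 1

deg : ∀ {n} → Mon n → ℕ
deg = sum

_∣ₘ_ : ∀ {n} → Mon n → Mon n → Set
_∣ₘ_ = Pointwise _≤_

_>lex_ : ∀ {n} → Mon n → Mon n → Set
[] >lex [] = ⊥
(a ∷ u) >lex (b ∷ v) = (a > b) ⊎ ((a ≡ b) × (u >lex v))

_≥lex_ : ∀ {n} → Mon n → Mon n → Set
u ≥lex v = (u ≡ v) ⊎ (u >lex v)

-- A monomial ideal of S, identified with its set of monomials:
-- a predicate on monomials closed under multiplication by monomials.
IsMonomialIdeal : ∀ {n} → (Mon n → Set) → Set
IsMonomialIdeal J = ∀ u v → J u → u ∣ₘ v → J v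

IsLexIdeal : ∀ {n} → (Mon n → Set) → Set
IsLexIdeal J = IsMonomialIdeal J × (∀ u v → J u → deg v ≡ deg u → v >lex u → J v)

IsMinGen : ∀ {n} → (Mon n → Set) → Mon n → Set
IsMinGen J u = J u × (∀ v → J v → v ∣ₘ u → v ≡ u)

InGdeg : ∀ {n} → (Mon n → Set) → ℕ → Mon n → Set
InGdeg J j u = IsMinGen J u × (deg u ≡ j)

module Submission where

-- For a monomial u and k ≤ deg u let  prefix k u  be the
-- lex-largest degree-k divisor of u (the degree-k truncation): walk along x_1, x_2, ... and take as much of
-- each exponent of u as still fits into degree k.  Writing m = x_p x_q, either
--   * prefix 2 u ≥lex m: then prefix 2 u ∈ J because J is a lex ideal, and it
--     divides u, so minimality of u forces prefix 2 u = u, impossible since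
--     deg u = j > 2; or
--   * m >lex prefix 2 u: then the general comparison lemma  lex-above-prefix
--     (if deg a = k and a >lex prefix k u then a·x_n^(deg u - k) >lex u) gives
--     m · x_n^(j-2) >lex u.

open import Defs
open import Data.Nat using (ℕ; zero; suc; _+_; _∸_; _≤_; _<_; _⊓_)
open import Data.Nat.Properties
open import Data.Fin using (Fin; fromℕ; zero; suc)
open import Data.Vec using ([]; _∷_; tabulate)
open import Data.Vec.Relation.Binary.Pointwise.Inductive using ([]; _∷_)
open import Data.Product using (_,_)
open import Data.Sum using (_⊎_; inj₁; inj₂)
open import Data.Empty using (⊥; ⊥-elim)
open import Relation.Binary.PropositionalEquality
  using (_≡_; refl; sym; trans; cong; cong₂; subst; module ≡-Reasoning)
open import Relation.Nullary using (yes; no)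
open import Relation.Binary.Definitions using (tri<; tri≈; tri>)
open import Algebra.Properties.CommutativeSemigroup +-commutativeSemigroup using (interchange)

deg-one : ∀ n → deg (tabulate {n = n} (λ _ → 0)) ≡ 0
deg-one zero    = refl
deg-one (suc n) = deg-one n

deg-pow : ∀ {n} (i : Fin n) k → deg (pow i k) ≡ k
deg-pow {suc n} zero    k = trans (cong (k +_) (deg-one n)) (+-identityʳ k)
deg-pow {suc n} (suc i) k = deg-pow i k

deg-· : ∀ {n} (a b : Mon n) → deg (a · b) ≡ deg a + deg b
deg-· []      []      = refl
deg-· (x ∷ a) (y ∷ b) = begin
  x + y + deg (a · b)     ≡⟨ cong (x + y +_) (deg-· a b) ⟩
  x + y + (deg a + deg b) ≡⟨ interchange x y (deg a) (deg b) ⟩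
  x + deg a + (y + deg b) ∎
  where open ≡-Reasoning

deg-var·var : ∀ {n} (p q : Fin n) → deg (var p · var q) ≡ 2
deg-var·var p q = trans (deg-· (var p) (var q)) (cong₂ _+_ (deg-pow p 1) (deg-pow q 1))

prefix : ∀ {n} → ℕ → Mon n → Mon n
prefix k []      = []
prefix k (c ∷ u) = (c ⊓ k) ∷ prefix (k ∸ c) u

prefix-∣ : ∀ {n} k (u : Mon n) → prefix k u ∣ₘ u
prefix-∣ k []      = []
prefix-∣ k (c ∷ u) = m⊓n≤m c k ∷ prefix-∣ (k ∸ c) u

deg-tail : ∀ {c k r d} → c ≤ k → c + d ≡ k + r → d ≡ (k ∸ c) + r
deg-tail {c} {k} {r} {d} c≤k eq = +-cancelˡ-≡ c d (k ∸ c + r) (begin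
  c + d             ≡⟨ eq ⟩
  k + r             ≡⟨ cong (_+ r) (sym (m+[n∸m]≡n c≤k)) ⟩
  c + (k ∸ c) + r   ≡⟨ +-assoc c (k ∸ c) r ⟩
  c + (k ∸ c + r)   ∎)
  where open ≡-Reasoning

deg-prefix : ∀ {n} k r (u : Mon n) → deg u ≡ k + r → deg (prefix k u) ≡ k
deg-prefix zero    zero []      _ = refl
deg-prefix (suc k) r    []      ()
deg-prefix zero    (suc r) []   ()
deg-prefix k       r    (c ∷ u) du with c ≤? k
... | yes c≤k = begin
  c ⊓ k + deg (prefix (k ∸ c) u) ≡⟨ cong₂ _+_ (m≤n⇒m⊓n≡m c≤k) (deg-prefix (k ∸ c) r u (deg-tail c≤k du)) ⟩
  c + (k ∸ c)                    ≡⟨ m+[n∸m]≡n c≤k ⟩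
  k                              ∎
  where open ≡-Reasoning
... | no c≰k = begin
  c ⊓ k + deg (prefix (k ∸ c) u) ≡⟨ cong₂ _+_ (m≥n⇒m⊓n≡n k≤c) (cong (λ z → deg (prefix z u)) (m≤n⇒m∸n≡0 k≤c)) ⟩
  k + deg (prefix 0 u)           ≡⟨ cong (k +_) (deg-prefix 0 (deg u) u refl) ⟩
  k + 0                          ≡⟨ +-identityʳ k ⟩
  k                              ∎
  where
  open ≡-Reasoning
  k≤c : k ≤ c
  k≤c = ≰⇒≥ c≰k

lex-total : ∀ {n} (x y : Mon n) → x ≥lex y ⊎ y >lex x
lex-total []      []      = inj₁ (inj₁ refl)
lex-total (a ∷ x) (b ∷ y) with <-cmp a b
... | tri< a<b _ _ = inj₂ (inj₁ a<b)
... | tri> _ _ a>b = inj₁ (inj₂ (inj₁ a>b))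
... | tri≈ _ refl _ with lex-total x y
...   | inj₁ (inj₁ refl) = inj₁ (inj₁ refl)
...   | inj₁ (inj₂ x>y)  = inj₁ (inj₂ (inj₂ (refl , x>y)))
...   | inj₂ y>x         = inj₂ (inj₂ (refl , y>x))

deg-zero-not->lex : ∀ {n} (a b : Mon n) → deg a ≡ 0 → a >lex b → ⊥
deg-zero-not->lex []          []      _  ()
deg-zero-not->lex (zero ∷ a)  (_ ∷ b) da (inj₂ (_ , a>b)) = deg-zero-not->lex a b da a>b
deg-zero-not->lex (suc _ ∷ _) (_ ∷ _) () _

-- If deg a = k, deg u = k + r and a >lex prefix k u,
-- then a · x_n^r >lex u: a beats u at the first place where a differs from the
-- prefix, and this place comes before the prefix has used up all of degree k.
lex-above-prefix : ∀ n (a u : Mon (suc n)) k r → deg a ≡ k → deg u ≡ k + r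
  → a >lex prefix k u → (a · pow (fromℕ n) r) >lex u
lex-above-prefix zero (e ∷ []) (c ∷ []) k r da du (inj₁ e>c⊓k) =
  ⊥-elim (<-irrefl (trans (sym da) (+-identityʳ e)) (subst (_< e) (m≥n⇒m⊓n≡n k≤c) e>c⊓k))
  where
  k≤c : k ≤ c
  k≤c = subst (k ≤_) (sym (trans (sym (+-identityʳ c)) du)) (m≤m+n k r)
lex-above-prefix (suc n) (e ∷ a) (c ∷ u) k r da du a>prefix with c ≤? k | a>prefix
... | no c≰k | inj₁ e>k =
  ⊥-elim (<⇒≱ (subst (_< e) (m≥n⇒m⊓n≡n (≰⇒≥ c≰k)) e>k) (subst (e ≤_) da (m≤m+n e (deg a))))
... | no c≰k | inj₂ (e≡k , a>rest) = ⊥-elim (deg-zero-not->lex a _ deg-a≡0 a>rest)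
  where
  deg-a≡0 : deg a ≡ 0
  deg-a≡0 = +-cancelˡ-≡ e (deg a) 0
    (trans da (trans (sym (trans e≡k (m≥n⇒m⊓n≡n (≰⇒≥ c≰k)))) (sym (+-identityʳ e))))
... | yes c≤k | inj₁ e>c =
  inj₁ (subst (c <_) (sym (+-identityʳ e)) (subst (_< e) (m≤n⇒m⊓n≡m c≤k) e>c))
... | yes c≤k | inj₂ (e≡c⊓k , a>rest) =
  inj₂ (trans (+-identityʳ e) e≡c , lex-above-prefix n a u (k ∸ c) r deg-a (deg-tail c≤k du) a>rest)
  where
  e≡c : e ≡ c
  e≡c = trans e≡c⊓k (m≤n⇒m⊓n≡m c≤k)
  deg-a : deg a ≡ k ∸ c
  deg-a = trans (sym (m+n∸m≡n e (deg a))) (cong₂ _∸_ da e≡c)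

lex-ideal-upward : ∀ {n} {J : Mon n → Set} → IsLexIdeal J
  → ∀ {m v} → J m → deg v ≡ deg m → v ≥lex m → J v
lex-ideal-upward _               Jm _     (inj₁ refl) = Jm
lex-ideal-upward (_ , lex-closed) Jm deg≡ (inj₂ v>m)  = lex-closed _ _ Jm deg≡ v>m

min-gen-divisor-deg : ∀ {n} {J : Mon n → Set} {u v} → IsMinGen J u
  → J v → v ∣ₘ u → deg v ≡ deg u
min-gen-divisor-deg (_ , minimal) Jv v∣u = cong deg (minimal _ Jv v∣u)

lemma4p2 : (n : ℕ) (J : Mon (suc n) → Set) → IsLexIdeal J
    → (j : ℕ) → 2 < j
    → (p q : Fin (suc n))
    → J (var p · var q)
    → (∀ m → deg m ≡ 2 → J m → m ≥lex (var p · var q))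
    → ∀ u → InGdeg J j u
    → ((var p · var q) · pow (fromℕ n) (j ∸ 2)) >lex u
lemma4p2 n J isLex j 2<j p q Jpq _ u (u-min , deg-u) =
  by-cases (lex-total (prefix 2 u) (var p · var q))
  where
  deg-u≡2+r : deg u ≡ 2 + (j ∸ 2)
  deg-u≡2+r = trans deg-u (sym (m+[n∸m]≡n (<⇒≤ 2<j)))
  deg-prefix≡2 : deg (prefix 2 u) ≡ 2
  deg-prefix≡2 = deg-prefix 2 (j ∸ 2) u deg-u≡2+r
  by-cases : prefix 2 u ≥lex (var p · var q) ⊎ (var p · var q) >lex prefix 2 u
    → ((var p · var q) · pow (fromℕ n) (j ∸ 2)) >lex u
  by-cases (inj₂ pq>prefix) =
    lex-above-prefix n (var p · var q) u 2 (j ∸ 2) (deg-var·var p q) deg-u≡2+r pq>prefix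
  by-cases (inj₁ prefix≥pq) = ⊥-elim (<-irrefl 2≡j 2<j)
    where
    prefix∈J : J (prefix 2 u)
    prefix∈J = lex-ideal-upward isLex Jpq (trans deg-prefix≡2 (sym (deg-var·var p q))) prefix≥pq
    2≡j : 2 ≡ j
    2≡j = trans (sym deg-prefix≡2) (trans (min-gen-divisor-deg u-min prefix∈J (prefix-∣ 2 u)) deg-u)
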